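{- Let $G$ be a graph of order $n$ with girth $g(G)=4$. Then $PC(G)=n$ if and only if $G$ is a complete bipartite graph.
   Context: The girth $g(G)$ of a graph with a cycle is the length of a shortest cycle. A paired dominating set of $G$ is a dominating set $S$ such that $G[S]$ has a perfect matching. Two disjoint sets form a paired coalition if neither is a paired dominating set but their union is. A $pc$-partition of $G$ is a partition of $V(G)$ into nonempty sets, none a paired dominating set, each forming a paired coalition with some other set of the partition. $PC(G)$ is the maximum number of sets in a $pc$-partition. -}

module Defs where

open import Data.Nat using (ℕ; zero; suc; _≤_; _+_)
open import Data.Fin using (Fin; zero; suc; inject₁; fromℕ)
open import Data.Bool using (Bool; true; false)
open import Data.Product using (Σ; ∃; ∃-syntax; _×_; _,_)
open import Data.Sum using (_⊎_)
open import Relation.Binary.PropositionalEquality using (_≡_; _≢_)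
open import Relation.Nullary using (¬_)
open import Relation.Unary using (Pred; _∪_; _∈_)
open import Level using (0ℓ)
open import Function.Definitions using (Injective; Surjective)

record Graph (n : ℕ) : Set where
  field
    adj    : Fin n → Fin n → Bool
    sym    : ∀ u v → adj u v ≡ adj v u
    irrefl : ∀ v → adj v v ≡ false

open Graph public

Adj : ∀ {n} → Graph n → Fin n → Fin n → Set
Adj G u v = adj G u v ≡ true

VSet : ℕ → Set₁
VSet n = Pred (Fin n) 0ℓ

HasCycle : ∀ {n} → Graph n → ℕ → Set
HasCycle {n} G k =
  Σ ℕ λ m → (k ≡ 3 + m) ×
    Σ (Fin (3 + m) → Fin n) λ c →
      Injective _≡_ _≡_ c ×
      (∀ (i : Fin (2 + m)) → Adj G (c (inject₁ i)) (c (suc i))) ×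
      Adj G (c (fromℕ (2 + m))) (c zero)

Girth : ∀ {n} → Graph n → ℕ → Set
Girth G g = HasCycle G g × (∀ k → HasCycle G k → g ≤ k)

Dominating : ∀ {n} → Graph n → VSet n → Set
Dominating G S = ∀ v → v ∈ S ⊎ (∃[ u ] (u ∈ S × Adj G u v))

-- G[S] has a perfect matching: a fixed-point-free involution m on S
-- pairing each vertex with an adjacent vertex of S.
HasPerfectMatching : ∀ {n} → Graph n → VSet n → Set
HasPerfectMatching {n} G S =
  Σ (Fin n → Fin n) λ m → (∀ v → v ∈ S → (m v ∈ S) × Adj G v (m v) × (m (m v) ≡ v))

PairedDominating : ∀ {n} → Graph n → VSet n → Set
PairedDominating G S = Dominating G S × HasPerfectMatching G S

Class : ∀ {n k} → (Fin n → Fin k) → Fin k → VSet n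
Class p i v = p v ≡ i

-- A pc-partition of G with k (nonempty) classes: p is surjective (classes
-- nonempty), no class is paired dominating, and each class forms a paired
-- coalition with some other (distinct, hence disjoint) class.
IsPCPartition : ∀ {n} → Graph n → (k : ℕ) → (Fin n → Fin k) → Set
IsPCPartition G k p =
  Surjective _≡_ _≡_ p ×
  (∀ i → ¬ PairedDominating G (Class p i)) ×
  (∀ i → ∃[ j ] (j ≢ i × PairedDominating G (Class p i ∪ Class p j)))

HasPCPartition : ∀ {n} → Graph n → ℕ → Set
HasPCPartition {n} G k = ∃[ p ] IsPCPartition G k p

PCNumber : ∀ {n} → Graph n → ℕ → Set
PCNumber G m = HasPCPartition G m × (∀ k → HasPCPartition G k → k ≤ m)

CompleteBipartite : ∀ {n} → Graph n → Set
CompleteBipartite {n} G =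
  Σ (Fin n → Bool) λ side →
    (∃[ a ] side a ≡ true) × (∃[ b ] side b ≡ false) ×
    (∀ u v → (Adj G u v → side u ≢ side v) × (side u ≢ side v → Adj G u v))

-- No pc-partition has more than n classes, and one with n classes consists of
-- singletons, none of which is paired dominating; so PC(G) = n exactly when
-- every vertex w lies on an edge wt whose ends dominate G. In a complete
-- bipartite graph every edge dominates and every vertex has a neighbour.
-- Conversely, fix a dominating edge uv of a triangle-free graph: every vertex
-- is adjacent to u or v, and triangle-freeness makes N(v) and N(u) disjoint
-- independent sets. For x ∈ N(v) and y ∈ N(u), take a dominating edge xx';
-- then x' ∈ N(u), so y ~ x' would close the triangle u x' y, hence y ~ x.
module Submission where

open import Defs hiding (sym)
open import Data.Nat using (ℕ; suc; _≤_; s≤s)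
open import Data.Nat.Properties using (n<1+n)
open import Data.Fin using (Fin; zero; suc; inject₁; punchOut; _≟_)
open import Data.Fin.Properties using (any?; punchOut-injective; injective⇒≤; <⇒notInjective)
open import Data.Bool using (Bool; true; false)
open import Data.Bool.Properties using (not-¬) renaming (_≟_ to _≟ᵇ_)
open import Data.Product using (∃-syntax; _×_; _,_; proj₁; proj₂; map₁; map₂)
open import Data.Sum using (_⊎_; inj₁; inj₂; [_,_])
import Data.Sum as Sum
open import Data.Empty using (⊥; ⊥-elim)
open import Function using (id; _∘_)
open import Function.Bundles using (_⇔_; mk⇔)
open import Function.Definitions using (Injective; Surjective)
open import Relation.Binary.PropositionalEquality using (_≡_; _≢_; refl; sym; trans; cong; module ≡-Reasoning)
open import Relation.Nullary using (¬_; yes; no; contradiction)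
open import Relation.Unary using (_∪_; _⊆_)

module _ {m n : ℕ} {f : Fin m → Fin n} (surj : Surjective _≡_ _≡_ f) where

  section : Fin n → Fin m
  section y = proj₁ (surj y)

  section-inverse : ∀ y → f (section y) ≡ y
  section-inverse y = proj₂ (surj y) refl

  section-injective : Injective _≡_ _≡_ section
  section-injective {x} {y} eq = begin
    x                ≡⟨ section-inverse x ⟨
    f (section x)    ≡⟨ cong f eq ⟩
    f (section y)    ≡⟨ section-inverse y ⟩
    y                ∎
    where open ≡-Reasoning

  surjective⇒≤ : n ≤ m
  surjective⇒≤ = injective⇒≤ section-injective

injective⇒surjective : ∀ {n} {f : Fin n → Fin n} → Injective _≡_ _≡_ f → Surjective _≡_ _≡_ f
injective⇒surjective {suc n} {f} inj y with any? (λ x → f x ≟ y)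
... | yes (x , fx≡y) = x , λ { refl → fx≡y }
... | no ∄x = ⊥-elim (<⇒notInjective (n<1+n n) punchOut∘f-injective)
  where
  punchOut∘f : Fin (suc n) → Fin n
  punchOut∘f x = punchOut {i = y} (λ y≡fx → ∄x (x , sym y≡fx))

  punchOut∘f-injective : Injective _≡_ _≡_ punchOut∘f
  punchOut∘f-injective {x} {x′} eq = inj (punchOut-injective {i = y} {j = f x} {k = f x′} _ _ eq)

surjective⇒injective : ∀ {n} {f : Fin n → Fin n} → Surjective _≡_ _≡_ f → Injective _≡_ _≡_ f
surjective⇒injective {f = f} surj {x} {y} fx≡fy = begin
  x                    ≡⟨ section∘f x ⟨
  section surj (f x)   ≡⟨ cong (section surj) fx≡fy ⟩
  section surj (f y)   ≡⟨ section∘f y ⟩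
  y                    ∎
  where
  open ≡-Reasoning

  section∘f : ∀ x → section surj (f x) ≡ x
  section∘f x with injective⇒surjective (section-injective surj) x
  ... | z , section[z]≡x rewrite sym (section[z]≡x refl) = cong (section surj) (section-inverse surj z)

module _ {n : ℕ} (G : Graph n) where

  Adj-irrefl : ∀ {u v} → Adj G u v → u ≢ v
  Adj-irrefl {u} uv refl = not-¬ uv (irrefl G u)

  Adj-sym : ∀ {u v} → Adj G u v → Adj G v u
  Adj-sym {u} {v} uv = trans (Graph.sym G v u) uv

  hasCycle⇒vertex : ∀ {k} → HasCycle G k → Fin n
  hasCycle⇒vertex (_ , _ , cycle , _) = cycle zero

  triangle⇒hasCycle : ∀ {a b c} → Adj G a b → Adj G b c → Adj G c a → HasCycle G 3
  triangle⇒hasCycle {a} {b} {c} ab bc ca = 0 , refl , vertex , vertex-injective , path , ca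
    where
    vertex : Fin 3 → Fin n
    vertex zero             = a
    vertex (suc zero)       = b
    vertex (suc (suc zero)) = c

    vertex-injective : Injective _≡_ _≡_ vertex
    vertex-injective {zero}             {zero}             _   = refl
    vertex-injective {zero}             {suc zero}         a≡b = contradiction a≡b (Adj-irrefl ab)
    vertex-injective {zero}             {suc (suc zero)}   a≡c = contradiction (sym a≡c) (Adj-irrefl ca)
    vertex-injective {suc zero}         {zero}             b≡a = contradiction (sym b≡a) (Adj-irrefl ab)
    vertex-injective {suc zero}         {suc zero}         _   = refl
    vertex-injective {suc zero}         {suc (suc zero)}   b≡c = contradiction b≡c (Adj-irrefl bc)
    vertex-injective {suc (suc zero)}   {zero}             c≡a = contradiction c≡a (Adj-irrefl ca)
    vertex-injective {suc (suc zero)}   {suc zero}         c≡b = contradiction (sym c≡b) (Adj-irrefl bc)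
    vertex-injective {suc (suc zero)}   {suc (suc zero)}   _   = refl

    path : ∀ i → Adj G (vertex (inject₁ i)) (vertex (suc i))
    path zero       = ab
    path (suc zero) = bc

  TriangleFree : Set
  TriangleFree = ∀ {a b c} → Adj G a b → Adj G b c → Adj G c a → ⊥

  girth4⇒triangleFree : Girth G 4 → TriangleFree
  girth4⇒triangleFree (_ , shortest) ab bc ca with shortest 3 (triangle⇒hasCycle ab bc ca)
  ... | s≤s (s≤s (s≤s ()))

  Dominating-mono : ∀ {S T : VSet n} → S ⊆ T → Dominating G S → Dominating G T
  Dominating-mono S⊆T dom v = Sum.map S⊆T (map₂ (map₁ S⊆T)) (dom v)

  singleton-noPerfectMatching : ∀ v → ¬ HasPerfectMatching G (_≡ v)
  singleton-noPerfectMatching v (m , matched) with matched v refl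
  ... | mv≡v , v~mv , _ = Adj-irrefl v~mv (sym mv≡v)

  edge-hasPerfectMatching : ∀ {u v} → Adj G u v → HasPerfectMatching G ((_≡ u) ∪ (_≡ v))
  edge-hasPerfectMatching {u} {v} uv = swap , matched
    where
    swap : Fin n → Fin n
    swap x with x ≟ u
    ... | yes _ = v
    ... | no  _ = u

    swap-u : swap u ≡ v
    swap-u with u ≟ u
    ... | yes _   = refl
    ... | no  u≢u = contradiction refl u≢u

    swap-v : swap v ≡ u
    swap-v with v ≟ u
    ... | yes v≡u = contradiction (sym v≡u) (Adj-irrefl uv)
    ... | no  _   = refl

    matched : ∀ x → x ≡ u ⊎ x ≡ v → (swap x ≡ u ⊎ swap x ≡ v) × Adj G x (swap x) × swap (swap x) ≡ x
    matched x (inj₁ refl) rewrite swap-u = inj₂ refl , uv , swap-v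
    matched x (inj₂ refl) rewrite swap-v = inj₁ refl , Adj-sym uv , swap-u

  DominatingEdge : Fin n → Fin n → Set
  DominatingEdge u v = Adj G u v × Dominating G ((_≡ u) ∪ (_≡ v))

  dominatingEdge⇒neighbour : ∀ {u v} → DominatingEdge u v → ∀ x → Adj G u x ⊎ Adj G v x
  dominatingEdge⇒neighbour (uv , dom) x with dom x
  ... | inj₁ (inj₁ refl)           = inj₂ (Adj-sym uv)
  ... | inj₁ (inj₂ refl)           = inj₁ uv
  ... | inj₂ (_ , inj₁ refl , ux)  = inj₁ ux
  ... | inj₂ (_ , inj₂ refl , vx)  = inj₂ vx

  dominatingEdges⇒singletonPCPartition : (∀ w → ∃[ t ] DominatingEdge w t) → IsPCPartition G n id
  dominatingEdges⇒singletonPCPartition dominatingEdge =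
    (λ y → y , id) ,
    (λ v → singleton-noPerfectMatching v ∘ proj₂) ,
    λ w → let t , wt , dom = dominatingEdge w in
          t , Adj-irrefl wt ∘ sym , dom , edge-hasPerfectMatching wt

  pcPartition⇒dominatingEdges : ∀ {p : Fin n → Fin n} → IsPCPartition G n p → ∀ w → ∃[ t ] DominatingEdge w t
  pcPartition⇒dominatingEdges {p} (surj , _ , coalition) w with coalition (p w)
  ... | j , _ , dom , m , matched with matched w (inj₁ refl)
  ...   | mw∈S , w~mw , _ = m w , w~mw , Dominating-mono ⊆edge dom
    where
    p-injective : Injective _≡_ _≡_ p
    p-injective = surjective⇒injective surj

    p[mw]≡j : p (m w) ≡ j
    p[mw]≡j = [ (λ p[mw]≡p[w] → contradiction (sym (p-injective p[mw]≡p[w])) (Adj-irrefl w~mw)) , id ]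
                mw∈S

    ⊆edge : Class p (p w) ∪ Class p j ⊆ (_≡ w) ∪ (_≡ m w)
    ⊆edge (inj₁ p[x]≡p[w]) = inj₁ (p-injective p[x]≡p[w])
    ⊆edge (inj₂ p[x]≡j)    = inj₂ (p-injective (trans p[x]≡j (sym p[mw]≡j)))

  completeBipartite⇒dominatingEdges : CompleteBipartite G → ∀ w → ∃[ t ] DominatingEdge w t
  completeBipartite⇒dominatingEdges (side , (a , side[a]) , (b , side[b]) , bipartite) w =
    t , across t≁w , dom
    where
    across : ∀ {x y} → side y ≢ side x → Adj G x y
    across {x} {y} y≁x = proj₂ (bipartite x y) (y≁x ∘ sym)

    opposite : ∀ s → ∃[ t ] side t ≢ s
    opposite true  = b , not-¬ side[b]
    opposite false = a , not-¬ side[a]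

    t = proj₁ (opposite (side w))
    t≁w = proj₂ (opposite (side w))

    dom : Dominating G ((_≡ w) ∪ (_≡ t))
    dom x with side x ≟ᵇ side w
    ... | yes x∼w = inj₂ (t , inj₂ refl , across (λ x∼t → t≁w (trans (sym x∼t) x∼w)))
    ... | no  x≁w = inj₂ (w , inj₁ refl , across x≁w)

  dominatingEdges⇒completeBipartite : TriangleFree → (∀ w → ∃[ t ] DominatingEdge w t) → Fin n →
                                      CompleteBipartite G
  dominatingEdges⇒completeBipartite triangleFree dominatingEdge u =
    side , (u , Adj-sym uv) , (v , irrefl G v) ,
    λ x y → adjacent⇒differentSides x y , differentSides⇒adjacent x y
    where
    v = proj₁ (dominatingEdge u)
    uv = proj₁ (proj₂ (dominatingEdge u))

    side : Fin n → Bool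
    side = adj G v

    side-false : ∀ {x} → side x ≡ false → ¬ Adj G v x
    side-false side[x]≡false vx = not-¬ vx side[x]≡false

    ¬v⇒u : ∀ {x} → ¬ Adj G v x → Adj G u x
    ¬v⇒u {x} ¬vx = [ id , (λ vx → contradiction vx ¬vx) ]
                     (dominatingEdge⇒neighbour (proj₂ (dominatingEdge u)) x)

    v-u-adjacent : ∀ {x y} → Adj G v x → ¬ Adj G v y → Adj G x y
    v-u-adjacent {x} {y} vx ¬vy with dominatingEdge x
    ... | x′ , xx′ , dom with dominatingEdge⇒neighbour (xx′ , dom) y
    ...   | inj₁ xy  = xy
    ...   | inj₂ x′y = ⊥-elim (triangleFree (¬v⇒u ¬vx′) x′y (Adj-sym (¬v⇒u ¬vy)))
      where
      ¬vx′ : ¬ Adj G v x′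
      ¬vx′ vx′ = triangleFree vx xx′ (Adj-sym vx′)

    adjacent⇒differentSides : ∀ x y → Adj G x y → side x ≢ side y
    adjacent⇒differentSides x y xy with side x in sx | side y in sy
    ... | true  | true  = λ _ → triangleFree sx xy (Adj-sym sy)
    ... | false | false = λ _ → triangleFree (¬v⇒u (side-false sx)) xy (Adj-sym (¬v⇒u (side-false sy)))
    ... | true  | false = λ ()
    ... | false | true  = λ ()

    differentSides⇒adjacent : ∀ x y → side x ≢ side y → Adj G x y
    differentSides⇒adjacent x y with side x in sx | side y in sy
    ... | true  | false = λ _ → v-u-adjacent sx (side-false sy)
    ... | false | true  = λ _ → Adj-sym (v-u-adjacent sy (side-false sx))
    ... | true  | true  = λ x≁y → contradiction refl x≁y
    ... | false | false = λ x≁y → contradiction refl x≁y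

mainTheorem14 : (n : ℕ) (G : Graph n) → Girth G 4 →
    (PCNumber G n ⇔ CompleteBipartite G)
mainTheorem14 n G girth4 = mk⇔
  (λ ((_ , isPCPartition) , _) →
    dominatingEdges⇒completeBipartite G (girth4⇒triangleFree G girth4)
      (pcPartition⇒dominatingEdges G isPCPartition) (hasCycle⇒vertex G (proj₁ girth4)))
  (λ completeBipartite →
    (id , dominatingEdges⇒singletonPCPartition G
            (completeBipartite⇒dominatingEdges G completeBipartite)) ,
    λ _ (_ , surj , _) → surjective⇒≤ surj)
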